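{- Let $W_{\Delta,n}$ be a Knödel graph with $\Delta\ge3$, let $s=2^{\Delta-1}-1$, and suppose $(4k-2)s+4\le n\le 4ks+2$ for some integer $k\ge\Delta-2$. Then: (i) $d(u_0,u_i)=2k$ for all $i$ with $(k-1)s+1\le i\le \frac n2-(k-1)s-1$; (ii) $d(u_0,v_j)=2k+1$ for all $j$ with $ks+1\le j\le\frac n2-(k-1)s-1$.
   Context: Knödel graph: for an even integer $n$ and an integer $\Delta$ with $1\le\Delta\le\lfloor\log_2 n\rfloor$, $W_{\Delta,n}$ is the simple bipartite graph with vertex set $U\cup V$, $U=\{u_0,\dots,u_{n/2-1}\}$, $V=\{v_0,\dots,v_{n/2-1}\}$; indices are read modulo $n/2$. The vertices $u_i$ and $v_j$ are adjacent iff $j-i\equiv 2^k-1\pmod{n/2}$ for some $k\in\{0,\dots,\Delta-1\}$; no other edges. $d(x,y)$ is the graph distance. -}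

module Defs where

open import Data.Nat using (ℕ; zero; suc; _+_; _*_; _∸_; _^_; _≤_; _<_; NonZero)
open import Data.Nat.DivMod using (_%_)
open import Data.Fin using (Fin; toℕ)
open import Data.Product using (Σ; _×_; ∃-syntax)
open import Data.Empty using (⊥)
open import Relation.Binary.PropositionalEquality using (_≡_)

-- Vertices of the Knödel graph W_{Δ,n} with n = 2 * h:
-- u i and v j for i, j ∈ {0, …, h-1}.
data Vertex (h : ℕ) : Set where
  u : Fin h → Vertex h
  v : Fin h → Vertex h

-- u_i ~ v_j  iff  j - i ≡ 2^k - 1 (mod h) for some k ∈ {0, …, Δ-1},
-- written as (i + (2^k - 1)) mod h = j.
KEdge : (Δ h : ℕ) → .{{NonZero h}} → Fin h → Fin h → Set
KEdge Δ h i j = ∃[ k ] (k < Δ × ((toℕ i + (2 ^ k ∸ 1)) % h ≡ toℕ j))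

Adj : (Δ h : ℕ) → .{{NonZero h}} → Vertex h → Vertex h → Set
Adj Δ h (u i) (v j) = KEdge Δ h i j
Adj Δ h (v j) (u i) = KEdge Δ h i j
Adj Δ h (u _) (u _) = ⊥
Adj Δ h (v _) (v _) = ⊥

data Walk (Δ h : ℕ) .{{_ : NonZero h}} : Vertex h → Vertex h → ℕ → Set where
  here : ∀ {x} → Walk Δ h x x 0
  step : ∀ {x y z ℓ} → Adj Δ h x y → Walk Δ h y z ℓ → Walk Δ h x z (suc ℓ)

Dist : (Δ h : ℕ) → .{{NonZero h}} → Vertex h → Vertex h → ℕ → Set
Dist Δ h x y d = Walk Δ h x y d × (∀ ℓ → Walk Δ h x y ℓ → d ≤ ℓ)

module Submission where

-- Write D = Δ − 1 and s = 2^D − 1.  Every edge joins u_i to v_{i + 2^p − 1}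
-- (p ≤ D), so along a walk a step u → v moves the position forward by a
-- jump 2^p − 1 ≤ s and a step v → u moves it backward by such a jump.
--
-- A walk u_0 → u_t of length 2m is a sequence of m round
-- trips u → v → u; it exists as soon as t (or t − h) is a signed sum
-- Σ (2^{p_r} − 1) − Σ (2^{q_r} − 1) of m round trips.  The representation
-- lemma shows, by binary recursion on the exponent bound L, that for
-- L ≤ m + 1 every 0 ≤ x ≤ m(2^L − 1) is such a sum.  Since h ≤ 2ks + 1,
-- one of t and h − t is at most ks; for v_j one first reaches u_{j−s}.
--
-- A walk with a forward and b backward steps (a = b from u
-- to u, a = b + 1 from u to v) ends, lifted to the integers, within
-- [−b·s, a·s].  Under the hypotheses on i and j this window neither
-- contains the target nor wraps around modulo h unless a, b are large.

open import Defs
open import Data.Nat using (ℕ; zero; suc; _+_; _*_; _∸_; _^_; _≤_; _<_; NonZero; z≤n; s≤s; _≤?_; _/_; _%_; pred)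
open import Data.Nat.Properties
open import Data.Nat.DivMod using (_mod_; m≡m%n+[m/n]*n; m%n<n; %-distribˡ-+; m%n%n≡m%n; [m+kn]%n≡m%n; [m+n]%n≡m%n; m<n⇒m%n≡m)
open import Data.Nat.ListAction using (sum)
open import Data.Nat.Tactic.RingSolver using (solve-∀)
open import Data.Fin using (Fin; toℕ; fromℕ<)
open import Data.Fin.Properties using (toℕ-injective; toℕ-fromℕ<; toℕ<n)
open import Data.Vec using (Vec; []; _∷_; map; replicate)
open import Data.Vec.Relation.Unary.All using (All; []; _∷_) renaming (map to all-map)
open import Data.Vec.Relation.Unary.All.Properties using (map⁺)
open import Data.List using (List; []; _∷_; length)
open import Data.Product using (_×_; _,_)
open import Data.Sum using (_⊎_; inj₁; inj₂)
open import Data.Empty using (⊥)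
open import Relation.Nullary using (Dec; yes; no)
open import Relation.Binary.PropositionalEquality using (_≡_; refl; sym; trans; cong; cong₂; subst; subst₂; module ≡-Reasoning)

jump : ℕ → ℕ
jump p = 2 ^ p ∸ 1

pow≡suc-jump : ∀ p → 2 ^ p ≡ suc (jump p)
pow≡suc-jump p = sym (trans (+-comm 1 (jump p)) (m∸n+n≡m (m^n>0 2 p)))

-- Doubling the exponent doubles the jump and adds one; this drives the
-- binary recursion in the representation lemma.
jump-suc : ∀ p → jump (suc p) ≡ suc (2 * jump p)
jump-suc p = begin
  2 * 2 ^ p ∸ 1         ≡⟨ cong (λ t → 2 * t ∸ 1) (pow≡suc-jump p) ⟩
  2 * suc (jump p) ∸ 1  ≡⟨ cong (_∸ 1) (*-suc 2 (jump p)) ⟩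
  suc (2 * jump p)      ∎
  where open ≡-Reasoning

jump-mono : ∀ {p q} → p ≤ q → jump p ≤ jump q
jump-mono p≤q = ∸-monoˡ-≤ 1 (^-monoʳ-≤ 2 p≤q)

jump-bit : ∀ b → b ≤ 1 → jump b ≡ b
jump-bit zero _ = refl
jump-bit (suc zero) _ = refl
jump-bit (suc (suc _)) (s≤s ())

jumps : ∀ {m} → Vec ℕ m → ℕ
jumps [] = 0
jumps (p ∷ ps) = jump p + jumps ps

jumps-replicate : ∀ m p → jumps (replicate m p) ≡ m * jump p
jumps-replicate zero p = refl
jumps-replicate (suc m) p = cong (jump p +_) (jumps-replicate m p)

jumps-double : ∀ {m} (ps : Vec ℕ m) → jumps (map suc ps) ≡ 2 * jumps ps + m
jumps-double [] = refl
jumps-double {suc m} (p ∷ ps) = begin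
  jump (suc p) + jumps (map suc ps)  ≡⟨ cong₂ _+_ (jump-suc p) (jumps-double ps) ⟩
  suc (2 * jump p) + (2 * jumps ps + m) ≡⟨ regroup (jump p) (jumps ps) m ⟩
  2 * (jump p + jumps ps) + suc m    ∎
  where
  open ≡-Reasoning
  regroup : ∀ a b m → suc (2 * a) + (2 * b + m) ≡ 2 * (a + b) + suc m
  regroup = solve-∀

-- Each pair (out_r, ret_r) will
-- become a round trip u → v → u of the Knödel graph.
record JumpSum (L m x : ℕ) : Set where
  constructor jumpSum
  field
    outs rets : Vec ℕ m
    outs≤ : All (_≤ L) outs
    rets≤ : All (_≤ L) rets
    balance : jumps outs ≡ x + jumps rets

all-replicate : ∀ {L} m {p} → p ≤ L → All (_≤ L) (replicate m p)
all-replicate zero _ = []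
all-replicate (suc m) p≤L = p≤L ∷ all-replicate m p≤L

stay : ∀ L m → JumpSum L m 0
stay L m = jumpSum zeros zeros (all-replicate m z≤n) (all-replicate m z≤n) refl
  where
  zeros : Vec ℕ m
  zeros = replicate m 0

unitsAmong : ∀ {d m} → d ≤ m → Vec ℕ m
unitsAmong {m = m} z≤n = replicate m 0
unitsAmong (s≤s d≤m) = 1 ∷ unitsAmong d≤m

unitsAmong-jumps : ∀ {d m} (d≤m : d ≤ m) → jumps (unitsAmong d≤m) ≡ d
unitsAmong-jumps {m = m} z≤n = trans (jumps-replicate m 0) (*-zeroʳ m)
unitsAmong-jumps (s≤s d≤m) = cong suc (unitsAmong-jumps d≤m)

unitsAmong-≤ : ∀ {L d m} (d≤m : d ≤ m) → All (_≤ suc L) (unitsAmong d≤m)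
unitsAmong-≤ {m = m} z≤n = all-replicate m z≤n
unitsAmong-≤ (s≤s d≤m) = s≤s z≤n ∷ unitsAmong-≤ d≤m

-- The top of the range: m maximal outward jumps, and each return jump of
-- length 0 or 1, covers every x with m·(2·jump L) ≤ x ≤ m·jump (L+1).
topmost : ∀ L m x → m * (2 * jump L) ≤ x → x ≤ m * jump (suc L) → JumpSum (suc L) m x
topmost L m x low x≤top = jumpSum (replicate m (suc L)) (unitsAmong d≤m)
    (all-replicate m ≤-refl) (unitsAmong-≤ d≤m) balance
  where
  top : ℕ
  top = m * jump (suc L)
  top≡ : top ≡ m + m * (2 * jump L)
  top≡ = trans (cong (m *_) (jump-suc L)) (*-suc m (2 * jump L))
  d≤m : top ∸ x ≤ m
  d≤m = begin
    top ∸ x                         ≤⟨ ∸-monoʳ-≤ top low ⟩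
    top ∸ m * (2 * jump L)          ≡⟨ cong (_∸ m * (2 * jump L)) top≡ ⟩
    m + m * (2 * jump L) ∸ m * (2 * jump L) ≡⟨ m+n∸n≡m m (m * (2 * jump L)) ⟩
    m                               ∎
    where open ≤-Reasoning
  balance : jumps (replicate m (suc L)) ≡ x + jumps (unitsAmong d≤m)
  balance = begin
    jumps (replicate m (suc L)) ≡⟨ jumps-replicate m (suc L) ⟩
    top                         ≡⟨ m+[n∸m]≡n x≤top ⟨
    x + (top ∸ x)               ≡⟨ cong (x +_) (unitsAmong-jumps d≤m) ⟨
    x + jumps (unitsAmong d≤m)  ∎
    where open ≡-Reasoning

-- Doubling every exponent of a representation of y and adding one more
-- round trip (p, q) represents x = 2y + jump p − jump q.
doubled : ∀ {L m y x p q} → JumpSum L m y → p ≤ suc L → q ≤ suc L →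
          jump p + 2 * y ≡ x + jump q → JumpSum (suc L) (suc m) x
doubled {m = m} {y} {x} {p} {q} (jumpSum outs rets outs≤ rets≤ bal) p≤ q≤ eq =
  jumpSum (p ∷ map suc outs) (q ∷ map suc rets)
    (p≤ ∷ map⁺ (all-map s≤s outs≤)) (q≤ ∷ map⁺ (all-map s≤s rets≤)) balance
  where
  open ≡-Reasoning
  regroup : ∀ a y r m → a + (2 * (y + r) + m) ≡ (a + 2 * y) + (2 * r + m)
  regroup = solve-∀
  balance : jump p + jumps (map suc outs) ≡ x + (jump q + jumps (map suc rets))
  balance = begin
    jump p + jumps (map suc outs)                 ≡⟨ cong (jump p +_) (jumps-double outs) ⟩
    jump p + (2 * jumps outs + m)                 ≡⟨ cong (λ t → jump p + (2 * t + m)) bal ⟩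
    jump p + (2 * (y + jumps rets) + m)           ≡⟨ regroup (jump p) y (jumps rets) m ⟩
    (jump p + 2 * y) + (2 * jumps rets + m)       ≡⟨ cong (_+ (2 * jumps rets + m)) eq ⟩
    (x + jump q) + (2 * jumps rets + m)           ≡⟨ +-assoc x (jump q) _ ⟩
    x + (jump q + (2 * jumps rets + m))           ≡⟨ cong (λ t → x + (jump q + t)) (jumps-double rets) ⟨
    x + (jump q + jumps (map suc rets))           ∎

-- When L ≤ m + 1, a single jump of exponent L is at most m jumps of that
-- exponent plus one; this is where the hypothesis L ≤ m + 1 enters.
jump≤multiple : ∀ L m → L ≤ suc m → jump L ≤ suc (m * jump L)
jump≤multiple L zero L≤1 = jump-mono L≤1
jump≤multiple L (suc m) _ = m≤n⇒m≤1+n (m≤m+n (jump L) (m * jump L))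

-- Below the top of the range, write x = b + 2q with b ∈ {0,1}.  Either
-- q ≤ m·jump L and (b, 0) finishes a representation of q, or q ≥ jump L
-- and the maximal round trip (L+1, 1−b) finishes one of q − jump L.
halving : ∀ L m x → (∀ y → y ≤ m * jump L → JumpSum L m y) →
          jump L ≤ suc (m * jump L) → x < suc m * (2 * jump L) → JumpSum (suc L) (suc m) x
halving L m x representL s≤ x<top = split (q ≤? m * s)
  where
  s b q : ℕ
  s = jump L
  b = x % 2
  q = x / 2
  b≤1 : b ≤ 1
  b≤1 = ≤-pred (m%n<n x 2)
  x≡ : x ≡ b + q * 2
  x≡ = m≡m%n+[m/n]*n x 2
  q<top : q < s + m * s
  q<top = *-cancelʳ-< _ q (s + m * s) (begin-strict
    q * 2                ≤⟨ m≤n+m (q * 2) b ⟩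
    b + q * 2            ≡⟨ x≡ ⟨
    x                    <⟨ x<top ⟩
    suc m * (2 * s)      ≡⟨ reorder m s ⟩
    (s + m * s) * 2      ∎)
    where
    open ≤-Reasoning
    reorder : ∀ m s → suc m * (2 * s) ≡ (s + m * s) * 2
    reorder = solve-∀
  split : Dec (q ≤ m * s) → JumpSum (suc L) (suc m) x
  split (yes q≤) = doubled (representL q q≤) (≤-trans b≤1 (s≤s z≤n)) z≤n low
    where
    open ≡-Reasoning
    low : jump b + 2 * q ≡ x + 0
    low = begin
      jump b + 2 * q ≡⟨ cong₂ _+_ (jump-bit b b≤1) (*-comm 2 q) ⟩
      b + q * 2      ≡⟨ x≡ ⟨
      x              ≡⟨ +-identityʳ x ⟨
      x + 0          ∎
  split (no q≰) = doubled (representL y y≤) ≤-refl (≤-trans (m∸n≤m 1 b) (s≤s z≤n)) high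
    where
    s≤q : s ≤ q
    s≤q = ≤-trans s≤ (≰⇒> q≰)
    y : ℕ
    y = q ∸ s
    y≤ : y ≤ m * s
    y≤ = ≤-trans (∸-monoˡ-≤ s (<⇒≤ q<top)) (≤-reflexive (m+n∸m≡n s (m * s)))
    open ≡-Reasoning
    regroup : ∀ s y → suc (2 * s) + 2 * y ≡ 1 + (y + s) * 2
    regroup = solve-∀
    regroup′ : ∀ b c q → (b + c) + q * 2 ≡ (b + q * 2) + c
    regroup′ = solve-∀
    high : jump (suc L) + 2 * y ≡ x + jump (1 ∸ b)
    high = begin
      jump (suc L) + 2 * y        ≡⟨ cong (_+ 2 * y) (jump-suc L) ⟩
      suc (2 * s) + 2 * y         ≡⟨ regroup s y ⟩
      1 + (y + s) * 2             ≡⟨ cong₂ (λ c t → c + t * 2) (m+[n∸m]≡n b≤1) (sym (m∸n+n≡m s≤q)) ⟨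
      (b + (1 ∸ b)) + q * 2       ≡⟨ regroup′ b (1 ∸ b) q ⟩
      (b + q * 2) + (1 ∸ b)       ≡⟨ cong₂ _+_ x≡ (jump-bit (1 ∸ b) (m∸n≤m 1 b)) ⟨
      x + jump (1 ∸ b)            ∎

represent : ∀ L m x → L ≤ suc m → x ≤ m * jump L → JumpSum L m x
represent zero m x _ x≤0 =
  subst (JumpSum 0 m) (sym (n≤0⇒n≡0 (≤-trans x≤0 (≤-reflexive (*-zeroʳ m))))) (stay 0 m)
represent (suc L) zero x _ x≤0 = subst (JumpSum (suc L) 0) (sym (n≤0⇒n≡0 x≤0)) (stay (suc L) 0)
represent (suc L) (suc m) x L≤ x≤top with suc m * (2 * jump L) ≤? x
... | yes large = topmost L (suc m) x large x≤top
... | no small = halving L m x (λ y → represent L m y (≤-pred L≤))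
                   (jump≤multiple L m (≤-pred L≤)) (≰⇒> small)

near-an-end : ∀ {h n} t → h ≤ 2 * n + 1 → t ≤ n ⊎ h ∸ t ≤ n
near-an-end {h} {n} t h≤ with t ≤? n
... | yes t≤n = inj₁ t≤n
... | no t≰n = inj₂ (begin
  h ∸ t                ≤⟨ ∸-mono h≤ (≰⇒> t≰n) ⟩
  2 * n + 1 ∸ suc n    ≡⟨ cong (_∸ suc n) (split n) ⟩
  suc n + n ∸ suc n    ≡⟨ m+n∸m≡n (suc n) n ⟩
  n                    ∎)
  where
  open ≤-Reasoning
  split : ∀ n → 2 * n + 1 ≡ suc n + n
  split = solve-∀

module Congruence (h : ℕ) .{{_ : NonZero h}} where

  infix 4 _≈_
  _≈_ : ℕ → ℕ → Set
  a ≈ b = a % h ≡ b % h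

  ≈-+ʳ : ∀ {a b} c → a ≈ b → a + c ≈ b + c
  ≈-+ʳ {a} {b} c a≈b = begin
    (a + c) % h             ≡⟨ %-distribˡ-+ a c h ⟩
    (a % h + c % h) % h     ≡⟨ cong (λ t → (t + c % h) % h) a≈b ⟩
    (b % h + c % h) % h     ≡⟨ %-distribˡ-+ b c h ⟨
    (b + c) % h             ∎
    where open ≡-Reasoning

  %-≈ : ∀ a → a % h ≈ a
  %-≈ a = m%n%n≡m%n a h

  -- Adding (h − 1)·c and then c is adding a multiple of h: this is how a
  -- backward jump of length c is performed with natural numbers.
  retreat : ∀ a c → a + pred h * c + c ≈ a
  retreat a c = trans (cong (_% h) rearranged) ([m+kn]%n≡m%n a c h)
    where
    open ≡-Reasoning
    rearrange : ∀ a p c → a + p * c + c ≡ a + c * suc p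
    rearrange = solve-∀
    rearranged : a + pred h * c + c ≡ a + c * h
    rearranged = trans (rearrange a (pred h) c) (cong (λ t → a + c * t) (suc-pred h))

  ≈-small : ∀ {a b} → a < h → b < h → a ≈ b → a ≡ b
  ≈-small a<h b<h a≈b = trans (sym (m<n⇒m%n≡m a<h)) (trans a≈b (m<n⇒m%n≡m b<h))

_++ʷ_ : ∀ {Δ h} .{{_ : NonZero h}} {x y z a b} →
        Walk Δ h x y a → Walk Δ h y z b → Walk Δ h x z (a + b)
here ++ʷ w′ = w′
step e w ++ʷ w′ = step e (w ++ʷ w′)

module KnödelGraph (D h : ℕ) .{{_ : NonZero h}} where
  open Congruence h

  Δ s : ℕ
  Δ = suc D
  s = jump D

  position : Vertex h → ℕ
  position (u i) = toℕ i
  position (v j) = toℕ j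

  side : Vertex h → ℕ
  side (u _) = 0
  side (v _) = 1

  toℕ-mod : ∀ n → toℕ (n mod h) ≡ n % h
  toℕ-mod n = toℕ-fromℕ< _

  roundTripWalk : ∀ {m} (outs rets : Vec ℕ m) → All (_≤ D) outs → All (_≤ D) rets →
                  (x y : Fin h) → toℕ x + jumps outs ≈ toℕ y + jumps rets →
                  Walk Δ h (u x) (u y) (2 * m)
  roundTripWalk [] [] [] [] x y x≈y =
    subst (λ y′ → Walk Δ h (u x) (u y′) 0) x≡y here
    where
    x≡y : x ≡ y
    x≡y = toℕ-injective (≈-small (toℕ<n x) (toℕ<n y)
            (subst₂ _≈_ (+-identityʳ (toℕ x)) (+-identityʳ (toℕ y)) x≈y))
  roundTripWalk {suc m} (p ∷ outs) (q ∷ rets) (p≤ ∷ outs≤) (q≤ ∷ rets≤) x y x≈y =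
    subst (Walk Δ h (u x) (u y)) (sym (*-suc 2 m))
      (step {y = v mid} outward (step inward (roundTripWalk outs rets outs≤ rets≤ next y onward)))
    where
    X N : ℕ
    X = toℕ x
    N = X + jump p + pred h * jump q
    mid next : Fin h
    mid = (X + jump p) mod h
    next = N mod h
    outward : Adj Δ h (u x) (v mid)
    outward = p , s≤s p≤ , sym (toℕ-mod (X + jump p))
    inward : Adj Δ h (v mid) (u next)
    inward = q , s≤s q≤ , returned
      where
      returned : (toℕ next + jump q) % h ≡ toℕ mid
      returned = begin
        (toℕ next + jump q) % h ≡⟨ cong (λ t → (t + jump q) % h) (toℕ-mod N) ⟩
        (N % h + jump q) % h    ≡⟨ ≈-+ʳ (jump q) (%-≈ N) ⟩
        (N + jump q) % h        ≡⟨ retreat (X + jump p) (jump q) ⟩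
        (X + jump p) % h        ≡⟨ toℕ-mod (X + jump p) ⟨
        toℕ mid                 ∎
        where open ≡-Reasoning
    onward : toℕ next + jumps outs ≈ toℕ y + jumps rets
    onward = begin
      (toℕ next + jumps outs) % h                     ≡⟨ cong (λ t → (t + jumps outs) % h) (toℕ-mod N) ⟩
      (N % h + jumps outs) % h                        ≡⟨ ≈-+ʳ (jumps outs) (%-≈ N) ⟩
      (N + jumps outs) % h                            ≡⟨ cong (_% h) (shuffle X (jump p) (pred h * jump q) (jumps outs)) ⟩
      (X + (jump p + jumps outs) + pred h * jump q) % h ≡⟨ ≈-+ʳ (pred h * jump q) x≈y ⟩
      (toℕ y + (jump q + jumps rets) + pred h * jump q) % h ≡⟨ cong (_% h) (shuffle′ (toℕ y) (jump q) (jumps rets) (pred h * jump q)) ⟩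
      (toℕ y + jumps rets + pred h * jump q + jump q) % h ≡⟨ retreat (toℕ y + jumps rets) (jump q) ⟩
      (toℕ y + jumps rets) % h                        ∎
      where
      open ≡-Reasoning
      shuffle : ∀ x a b c → x + a + b + c ≡ x + (a + c) + b
      shuffle = solve-∀
      shuffle′ : ∀ y a c b → y + (a + c) + b ≡ y + c + b + a
      shuffle′ = solve-∀

  forward backward : ∀ {x y ℓ} → Walk Δ h x y ℓ → List ℕ
  forward here = []
  forward (step {x = u _} {y = v _} (p , _) w) = jump p ∷ forward w
  forward (step {x = v _} {y = u _} _ w) = forward w
  forward (step {x = u _} {y = u _} () _)
  forward (step {x = v _} {y = v _} () _)

  backward here = []
  backward (step {x = u _} {y = v _} _ w) = backward w
  backward (step {x = v _} {y = u _} (p , _) w) = jump p ∷ backward w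
  backward (step {x = u _} {y = u _} () _)
  backward (step {x = v _} {y = v _} () _)

  steps-total : ∀ {x y ℓ} (w : Walk Δ h x y ℓ) → length (forward w) + length (backward w) ≡ ℓ
  steps-total here = refl
  steps-total (step {x = u _} {y = v _} _ w) = cong suc (steps-total w)
  steps-total (step {x = v _} {y = u _} _ w) = trans (+-suc _ _) (cong suc (steps-total w))

  steps-alternate : ∀ {x y ℓ} (w : Walk Δ h x y ℓ) →
                    length (forward w) + side x ≡ length (backward w) + side y
  steps-alternate here = refl
  steps-alternate (step {x = u _} {y = v _} _ w) = trans (sym (+-suc _ 0)) (steps-alternate w)
  steps-alternate (step {x = v _} {y = u _} _ w) = trans (+-suc _ 0) (cong suc (steps-alternate w))

  forward-short : ∀ {x y ℓ} (w : Walk Δ h x y ℓ) → sum (forward w) ≤ length (forward w) * s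
  forward-short here = z≤n
  forward-short (step {x = u _} {y = v _} (p , s≤s p≤D , _) w) = +-mono-≤ (jump-mono p≤D) (forward-short w)
  forward-short (step {x = v _} {y = u _} _ w) = forward-short w

  backward-short : ∀ {x y ℓ} (w : Walk Δ h x y ℓ) → sum (backward w) ≤ length (backward w) * s
  backward-short here = z≤n
  backward-short (step {x = u _} {y = v _} _ w) = backward-short w
  backward-short (step {x = v _} {y = u _} (p , s≤s p≤D , _) w) = +-mono-≤ (jump-mono p≤D) (backward-short w)

  displacement : ∀ {x y ℓ} (w : Walk Δ h x y ℓ) →
                 position x + sum (forward w) ≈ position y + sum (backward w)
  displacement here = refl
  displacement {y = z} (step {x = u i} {y = v j} (p , _ , edge) w) = begin
    (toℕ i + (jump p + F)) % h   ≡⟨ cong (_% h) (+-assoc (toℕ i) (jump p) F) ⟨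
    (toℕ i + jump p + F) % h     ≡⟨ ≈-+ʳ F (%-≈ (toℕ i + jump p)) ⟨
    ((toℕ i + jump p) % h + F) % h ≡⟨ cong (λ t → (t + F) % h) edge ⟩
    (toℕ j + F) % h              ≡⟨ displacement w ⟩
    (position z + sum (backward w)) % h ∎
    where
    open ≡-Reasoning
    F : ℕ
    F = sum (forward w)
  displacement {y = z} (step {x = v j} {y = u i} (p , _ , edge) w) = begin
    (toℕ j + F) % h              ≡⟨ cong (λ t → (t + F) % h) edge ⟨
    ((toℕ i + jump p) % h + F) % h ≡⟨ ≈-+ʳ F (%-≈ (toℕ i + jump p)) ⟩
    (toℕ i + jump p + F) % h     ≡⟨ cong (_% h) (swap-last (toℕ i) (jump p) F) ⟩
    (toℕ i + F + jump p) % h     ≡⟨ ≈-+ʳ (jump p) (displacement w) ⟩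
    (position z + B + jump p) % h ≡⟨ cong (_% h) (swap-last′ (position z) B (jump p)) ⟩
    (position z + (jump p + B)) % h ∎
    where
    open ≡-Reasoning
    F B : ℕ
    F = sum (forward w)
    B = sum (backward w)
    swap-last : ∀ a b c → a + b + c ≡ a + c + b
    swap-last = solve-∀
    swap-last′ : ∀ a b c → a + b + c ≡ a + (c + b)
    swap-last′ = solve-∀

  -- Lifted to the integers, a walk from u_0 with a forward and b backward
  -- steps ends in [−b·s, a·s].  If that window lies strictly between t − h
  -- and t, the walk cannot end at position t.
  no-shortcut : ∀ {z y ℓ} (w : Walk Δ h (u z) y ℓ) → toℕ z ≡ 0 →
                length (forward w) * s < position y →
                position y + length (backward w) * s < h → ⊥
  no-shortcut {z} {y} w z≡0 ahead<t behind<h = <⇒≱ P<t (≤-trans (m≤m+n t Q) (≤-reflexive (sym P≡t+Q)))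
    where
    t P Q : ℕ
    t = position y
    P = sum (forward w)
    Q = sum (backward w)
    P<t : P < t
    P<t = ≤-<-trans (forward-short w) ahead<t
    t+Q<h : t + Q < h
    t+Q<h = ≤-<-trans (+-monoʳ-≤ t (backward-short w)) behind<h
    P≡t+Q : P ≡ t + Q
    P≡t+Q = ≈-small (<-trans P<t (≤-<-trans (m≤m+n t Q) t+Q<h)) t+Q<h
              (subst (λ a → a + P ≈ t + Q) z≡0 (displacement w))

  u-lower : ∀ c {z i ℓ} (w : Walk Δ h (u z) (u i) ℓ) → toℕ z ≡ 0 →
            c * s < toℕ i → toℕ i + c * s < h → 2 * suc c ≤ ℓ
  u-lower c {i = i} {ℓ} w z≡0 far-ahead far-behind = begin
    2 * suc c       ≡⟨ twice (suc c) ⟩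
    suc c + suc c   ≤⟨ +-mono-≤ c<a (subst (suc c ≤_) a≡b c<a) ⟩
    a + b           ≡⟨ steps-total w ⟩
    ℓ               ∎
    where
    open ≤-Reasoning
    twice : ∀ n → 2 * n ≡ n + n
    twice = solve-∀
    a b : ℕ
    a = length (forward w)
    b = length (backward w)
    a≡b : a ≡ b
    a≡b = +-cancelʳ-≡ 0 a b (steps-alternate w)
    c<a : suc c ≤ a
    c<a = ≮⇒≥ λ a≤c → no-shortcut w z≡0
      (≤-<-trans (*-monoˡ-≤ s (≤-pred a≤c)) far-ahead)
      (≤-<-trans (+-monoʳ-≤ (toℕ i) (*-monoˡ-≤ s (≤-pred (subst (_< suc c) a≡b a≤c)))) far-behind)

  v-lower : ∀ c {z j ℓ} (w : Walk Δ h (u z) (v j) ℓ) → toℕ z ≡ 0 →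
            suc c * s < toℕ j → toℕ j + c * s < h → 2 * suc c + 1 ≤ ℓ
  v-lower c {j = j} {ℓ} w z≡0 far-ahead far-behind = begin
    2 * suc c + 1         ≡⟨ twice+1 c ⟩
    suc (suc c) + suc c   ≤⟨ +-mono-≤ (s≤s c<b) c<b ⟩
    suc b + b             ≡⟨ cong (_+ b) a≡1+b ⟨
    a + b                 ≡⟨ steps-total w ⟩
    ℓ                     ∎
    where
    open ≤-Reasoning
    twice+1 : ∀ n → 2 * suc n + 1 ≡ suc (suc n) + suc n
    twice+1 = solve-∀
    a b : ℕ
    a = length (forward w)
    b = length (backward w)
    a≡1+b : a ≡ suc b
    a≡1+b = trans (sym (+-identityʳ a)) (trans (steps-alternate w) (+-comm b 1))
    c<b : suc c ≤ b
    c<b = ≮⇒≥ λ b≤c → no-shortcut w z≡0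
      (≤-<-trans (*-monoˡ-≤ s (subst (_≤ suc c) (sym a≡1+b) b≤c)) far-ahead)
      (≤-<-trans (+-monoʳ-≤ (toℕ j) (*-monoˡ-≤ s (≤-pred b≤c))) far-behind)

  u-walk : ∀ m → D ≤ suc m → (z t : Fin h) → toℕ z ≡ 0 →
           toℕ t ≤ m * s ⊎ h ∸ toℕ t ≤ m * s → Walk Δ h (u z) (u t) (2 * m)
  u-walk m D≤ z t z≡0 (inj₁ t≤) = roundTripWalk outs rets outs≤ rets≤ z t (cong (_% h) start)
    where
    open JumpSum (represent D m (toℕ t) D≤ t≤)
    start : toℕ z + jumps outs ≡ toℕ t + jumps rets
    start = trans (cong (_+ jumps outs) z≡0) balance
  u-walk m D≤ z t z≡0 (inj₂ h-t≤) = roundTripWalk rets outs rets≤ outs≤ z t start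
    where
    open JumpSum (represent D m (h ∸ toℕ t) D≤ h-t≤)
    open ≡-Reasoning
    R : ℕ
    R = jumps rets
    start : toℕ z + R ≈ toℕ t + jumps outs
    start = begin
      (toℕ z + R) % h                 ≡⟨ cong (λ a → (a + R) % h) z≡0 ⟩
      R % h                           ≡⟨ [m+n]%n≡m%n R h ⟨
      (R + h) % h                     ≡⟨ cong (λ a → (R + a) % h) (m+[n∸m]≡n (<⇒≤ (toℕ<n t))) ⟨
      (R + (toℕ t + (h ∸ toℕ t))) % h ≡⟨ cong (_% h) (rotate R (toℕ t) (h ∸ toℕ t)) ⟩
      (toℕ t + (h ∸ toℕ t + R)) % h   ≡⟨ cong (λ a → (toℕ t + a) % h) balance ⟨
      (toℕ t + jumps outs) % h        ∎
      where
      rotate : ∀ r a b → r + (a + b) ≡ a + (b + r)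
      rotate = solve-∀

  u-distance : ∀ c → D ≤ suc (suc c) → h ≤ 2 * (suc c * s) + 1 →
               (z i : Fin h) → toℕ z ≡ 0 → c * s < toℕ i → toℕ i + c * s < h →
               Dist Δ h (u z) (u i) (2 * suc c)
  u-distance c D≤ h≤ z i z≡0 far-ahead far-behind =
    u-walk (suc c) D≤ z i z≡0 (near-an-end (toℕ i) h≤) ,
    λ ℓ w → u-lower c w z≡0 far-ahead far-behind

  -- Part (ii) of the theorem, with k = c + 1: go to u_{j−s} in 2k steps,
  -- then take the longest jump.
  v-distance : ∀ c → D ≤ suc (suc c) → h ≤ 2 * (suc c * s) + 1 →
               (z j : Fin h) → toℕ z ≡ 0 → suc c * s < toℕ j → toℕ j + c * s < h →
               Dist Δ h (u z) (v j) (2 * suc c + 1)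
  v-distance c D≤ h≤ z j z≡0 far-ahead far-behind =
    u-walk (suc c) D≤ z t z≡0 (inj₁ t≤) ++ʷ step last here ,
    λ ℓ w → v-lower c w z≡0 far-ahead far-behind
    where
    s≤j : s ≤ toℕ j
    s≤j = ≤-trans (m≤m+n s (c * s)) (<⇒≤ far-ahead)
    t : Fin h
    t = fromℕ< (≤-<-trans (m∸n≤m (toℕ j) s) (toℕ<n j))
    j≤ : toℕ j ≤ s + suc c * s
    j≤ = +-cancelʳ-≤ (c * s) (toℕ j) (s + suc c * s) (≤-pred (begin
      suc (toℕ j + c * s)           ≤⟨ ≤-trans far-behind h≤ ⟩
      2 * (suc c * s) + 1           ≡⟨ unfold c s ⟩
      suc (s + suc c * s + c * s)   ∎))
      where
      open ≤-Reasoning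
      unfold : ∀ c s → 2 * (suc c * s) + 1 ≡ suc (s + suc c * s + c * s)
      unfold = solve-∀
    t≤ : toℕ t ≤ suc c * s
    t≤ = begin
      toℕ t                   ≡⟨ toℕ-fromℕ< _ ⟩
      toℕ j ∸ s               ≤⟨ ∸-monoˡ-≤ s j≤ ⟩
      s + suc c * s ∸ s       ≡⟨ m+n∸m≡n s (suc c * s) ⟩
      suc c * s               ∎
      where open ≤-Reasoning
    last : Adj Δ h (u t) (v j)
    last = D , n<1+n D , (begin
      (toℕ t + s) % h         ≡⟨ cong (λ a → (a + s) % h) (toℕ-fromℕ< _) ⟩
      (toℕ j ∸ s + s) % h     ≡⟨ cong (_% h) (m∸n+n≡m s≤j) ⟩
      toℕ j % h               ≡⟨ m<n⇒m%n≡m (toℕ<n j) ⟩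
      toℕ j                   ∎)
      where open ≡-Reasoning

+1≤⇒< : ∀ {m n} → m + 1 ≤ n → m < n
+1≤⇒< {m} {n} = subst (_≤ n) (+-comm m 1)

mainTheorem13 : (Δ h k : ℕ) → .{{_ : NonZero h}} →
    3 ≤ Δ → 2 ^ Δ ≤ 2 * h →
    Δ ∸ 2 ≤ k →
    (4 * k ∸ 2) * (2 ^ (Δ ∸ 1) ∸ 1) + 4 ≤ 2 * h →
    2 * h ≤ 4 * k * (2 ^ (Δ ∸ 1) ∸ 1) + 2 →
    ((i : Fin h) →
      (k ∸ 1) * (2 ^ (Δ ∸ 1) ∸ 1) + 1 ≤ toℕ i →
      toℕ i + (k ∸ 1) * (2 ^ (Δ ∸ 1) ∸ 1) + 1 ≤ h →
      (z : Fin h) → toℕ z ≡ 0 → Dist Δ h (u z) (u i) (2 * k))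
    ×
    ((j : Fin h) →
      k * (2 ^ (Δ ∸ 1) ∸ 1) + 1 ≤ toℕ j →
      toℕ j + (k ∸ 1) * (2 ^ (Δ ∸ 1) ∸ 1) + 1 ≤ h →
      (z : Fin h) → toℕ z ≡ 0 → Dist Δ h (u z) (v j) (2 * k + 1))
-- Write Δ = E + 3 and k = c + 1 (so k ≥ Δ − 2 ≥ 1 gives D = Δ − 1 ≤ k + 1).
mainTheorem13 Δ h k (s≤s (s≤s (s≤s {n = E} _))) _ (s≤s {n = c} E≤c) _ h-upper =
  (λ i near far z z≡0 → u-distance c D≤ h≤ z i z≡0 (+1≤⇒< near) (+1≤⇒< far)) ,
  (λ j near far z z≡0 → v-distance c D≤ h≤ z j z≡0 (+1≤⇒< near) (+1≤⇒< far))
  where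
  open KnödelGraph (suc (suc E)) h
  D≤ : suc (suc E) ≤ suc (suc c)
  D≤ = s≤s (s≤s E≤c)
  h≤ : h ≤ 2 * (suc c * s) + 1
  h≤ = *-cancelˡ-≤ 2 (begin
    2 * h                         ≤⟨ h-upper ⟩
    4 * suc c * s + 2             ≡⟨ halve c s ⟩
    2 * (2 * (suc c * s) + 1)     ∎)
    where
    open ≤-Reasoning
    halve : ∀ c s → 4 * suc c * s + 2 ≡ 2 * (2 * (suc c * s) + 1)
    halve = solve-∀
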